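{- Let $p$ be a prime, $\delta\in\mathbb{C}^*$, and $X=p^s$ a formal variable. For $n\ge1$ put $$A_n=\delta^{2n}+\delta^{ -2n}-(p-1)\left(\delta^{2n-2}+\delta^{2n-4}+\cdots+\delta^{ -2n+4}+\delta^{ -2n+2}\right)$$ (equal to $\delta^{2n}+\delta^{ -2n}-(p-1)\frac{\delta^{2n-1}-\delta^{ -2n+1}}{\delta-\delta^{ -1}}$ when $\delta\ne\pm1$), and $F_{ev}(s)=1+\sum_{n\ge1}A_np^{2ns-n}$. Then for every $n\ge0$, $$\int\varphi_{2n}(s)F_{ev}(s)\,ds=\begin{cases}1&n=0,\\ \delta^{2n}+\delta^{ -2n}&n\ge1.\end{cases}$$
   Context: $\varphi_0(s)=1$ and, for $m\ge1$, $\varphi_m(s)=p^{m/2}\left[p^{ms}+p^{ -ms}+\left(1-\frac1p\right)\sum_{j=1}^{m-1}p^{(m-2j)s}\right]$ (the Satake transform of the characteristic function of $ZK\,\mathrm{diag}(p^m,1)K$ in $GL(2,\mathbb{Q}_p)$). The integral is over $s\in i\mathbb{R}/(2\pi i(\ln p)^{ -1}\mathbb{Z})$ with measure normalized so that $\int p^{ns}p^{ms}ds=1$ if $n+m=0$ and $0$ otherwise; equivalently (and in particular whenever the series converges), regarding $\varphi_{2n}$ as a Laurent polynomial and $F_{ev}$ as a formal power series in $X=p^s$, $\int\varphi_{2n}F_{ev}\,ds$ is the coefficient of $X^0$ in the product $\varphi_{2n}F_{ev}$. -}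

module Defs where

open import Level using (Level)
open import Algebra.Bundles using (CommutativeRing; Semiring)
open import Data.Nat as ℕ using (ℕ; zero; suc)
open import Data.Integer as ℤ using (ℤ; +_; -[1+_])
open import Data.List using (List; []; _∷_; map; foldr; upTo)
open import Relation.Nullary.Decidable using (does)
open import Data.Bool using (if_then_else_)

-- Laurent polynomials / formal power series in X = p^s over a commutative
-- ring R are represented by their coefficient functions.
module Setup {c ℓ : Level} (R : CommutativeRing c ℓ) where
  open CommutativeRing R
  open Semiring semiring using (rawSemiring)
  open import Algebra.Definitions.RawSemiring rawSemiring using (_×_; _^_)

  Σ : {A : Set} → List A → (A → Carrier) → Carrier
  Σ xs f = foldr (λ a acc → f a + acc) 0# xs

  -- Σ_{j = a}^{b} f j over naturals (a ≤ j ≤ b; empty if b < a)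
  Σ[_⋯_] : ℕ → ℕ → (ℕ → Carrier) → Carrier
  Σ[ a ⋯ b ] f = Σ (map (a ℕ.+_) (upTo (suc b ℕ.∸ a))) f

  [_≡ᶻ_] : ℤ → ℤ → Carrier
  [ x ≡ᶻ y ] = if does (x ℤ.≟ y) then 1# else 0#

  zpow : Carrier → Carrier → ℤ → Carrier
  zpow x xinv (+ k)      = x ^ k
  zpow x xinv -[1+ k ]   = xinv ^ suc k

  ⟦_⟧ : ℕ → Carrier
  ⟦ p ⟧ = p × 1#

  -- Coefficient of X^e in φ_{2n}(s), where φ_0 = 1 and for m = 2n ≥ 1
  -- φ_m = p^{m/2} [ X^m + X^{-m} + (1 - 1/p) Σ_{j=1}^{m-1} X^{m-2j} ],
  -- p^{m/2} = p^n.
  φ2coeff : (p : ℕ) (pinv : Carrier) (n : ℕ) → ℤ → Carrier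
  φ2coeff p pinv zero    e = [ e ≡ᶻ + 0 ]
  φ2coeff p pinv (suc k) e =
    let m = 2 ℕ.* suc k in
    ⟦ p ⟧ ^ suc k *
      ( [ e ≡ᶻ + m ] + [ e ≡ᶻ ℤ.- (+ m) ]
      + (1# - pinv) * Σ[ 1 ⋯ m ℕ.∸ 1 ] (λ j → [ e ≡ᶻ (+ m) ℤ.- (+ (2 ℕ.* j)) ]) )

  A : (p : ℕ) (δ δinv : Carrier) (n : ℕ) → Carrier
  A p δ δinv n =
    zpow δ δinv (+ (2 ℕ.* n)) + zpow δ δinv (ℤ.- (+ (2 ℕ.* n)))
    - (⟦ p ⟧ - 1#) * Σ[ 1 ⋯ 2 ℕ.* n ℕ.∸ 1 ]
          (λ j → zpow δ δinv ((+ (2 ℕ.* n)) ℤ.- (+ (2 ℕ.* j))))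

  -- Coefficient of X^k in F_ev = 1 + Σ_{n≥1} A_n p^{2ns-n} = 1 + Σ_{n≥1} A_n p^{-n} X^{2n}.
  Fcoeff : (p : ℕ) (pinv δ δinv : Carrier) → ℤ → Carrier
  Fcoeff p pinv δ δinv (+ k) =
    [ + k ≡ᶻ + 0 ] + Σ[ 1 ⋯ k ] (λ i → [ + k ≡ᶻ + (2 ℕ.* i) ] * (A p δ δinv i * pinv ^ i))
  Fcoeff p pinv δ δinv -[1+ k ]          = 0#

  -- ∫ φ_{2n} F_ev ds := coefficient of X^0 in φ_{2n} · F_ev
  --                   = Σ_{e = -2n}^{2n} [X^e]φ_{2n} · [X^{-e}]F_ev
  -- (φ_{2n} has no coefficients outside exponents -2n … 2n).
  integral : (p : ℕ) (pinv δ δinv : Carrier) (n : ℕ) → Carrier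
  integral p pinv δ δinv n =
    Σ[ 0 ⋯ 4 ℕ.* n ] (λ i →
      let e = (+ i) ℤ.- (+ (2 ℕ.* n)) in
      φ2coeff p pinv n e * Fcoeff p pinv δ δinv (ℤ.- e))

case-n : {a : Level} {A : Set a} → ℕ → A → A → A
case-n zero    x y = x
case-n (suc _) x y = y

-- Write Bₙ = δ^{2n} + δ^{-2n} and let Tₖ = Σ_{r≤k} [X^{2r}]F_ev and Uₖ = 1 + Σ_{1≤r≤k} Bᵣ.
-- The sum δ^{2n-2} + ⋯ + δ^{-2n+2} in Aₙ is symmetric about δ⁰, hence equals U_{n-1}, so
-- Aₙ = Bₙ - (p - 1) U_{n-1}; with [X^{2n}]F_ev = Aₙ p^{-n} this gives pᵏ Tₖ = Uₖ by induction.
-- Pairing φ_{2n} with F_ev picks out [X^{2n}]F_ev, [X^{-2n}]F_ev = 0 and the coefficients at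
-- X^{2j-2n} (0 < j < 2n), of which only the even nonnegative exponents survive; the integral is
-- pⁿ ([X^{2n}]F_ev + (1 - 1/p) T_{n-1}) = Aₙ + (p - 1) U_{n-1} = Bₙ.
module Submission where

open import Defs
open import Level using (Level)
open import Algebra.Bundles using (CommutativeRing; Semiring)
open import Data.Nat as ℕ using (ℕ; zero; suc; _∸_; s≤s)
import Data.Nat.Properties as ℕ
open import Data.Integer as ℤ using (ℤ; +_; -[1+_])
import Data.Integer.Properties as ℤ
open import Data.Fin using (Fin; toℕ; fromℕ; fromℕ<; inject₁; punchIn)
import Data.Fin.Properties as Fin
open import Data.List using (map; applyUpTo)
open import Data.Bool using (if_then_else_)
open import Function using (id; _∘_)
open import Relation.Binary.PropositionalEquality using (_≡_; _≢_; cong; module ≡-Reasoning)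
import Relation.Binary.PropositionalEquality as ≡
open import Relation.Nullary.Decidable using (dec-true; dec-false)
import Data.Integer.Tactic.RingSolver as ℤ-Solver
import Data.Nat.Tactic.RingSolver as ℕ-Solver
open import Data.Nat.Primality using (Prime)

+[1+m]-+[1+n]≡+m-+n : ∀ m n → + suc m ℤ.- + suc n ≡ + m ℤ.- + n
+[1+m]-+[1+n]≡+m-+n m n = begin
  + suc m ℤ.- + suc n ≡⟨ ℤ.m-n≡m⊖n (suc m) (suc n) ⟩
  suc m ℤ.⊖ suc n     ≡⟨ ℤ.[1+m]⊖[1+n]≡m⊖n m n ⟩
  m ℤ.⊖ n             ≡⟨ ℤ.m-n≡m⊖n m n ⟨
  + m ℤ.- + n         ∎
  where open ≡-Reasoning

+m-+[1+m+m]≡-[1+m] : ∀ m → + m ℤ.- + suc (m ℕ.+ m) ≡ -[1+ m ]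
+m-+[1+m+m]≡-[1+m] m = begin
  + m ℤ.- + suc (m ℕ.+ m)   ≡⟨ ℤ.m-n≡m⊖n m (suc (m ℕ.+ m)) ⟩
  m ℤ.⊖ suc (m ℕ.+ m)       ≡⟨ ℤ.⊖-< (s≤s (ℕ.m≤m+n m m)) ⟩
  ℤ.- + (suc (m ℕ.+ m) ∸ m) ≡⟨ cong (ℤ.-_ ∘ +_) (≡.trans (cong (_∸ m) (≡.sym (ℕ.+-suc m m))) (ℕ.m+n∸m≡n m (suc m))) ⟩
  -[1+ m ]                  ∎
  where open ≡-Reasoning

+m-+n≡+m′-+n⇒m≡m′ : ∀ {m m′ n} → + m ℤ.- + n ≡ + m′ ℤ.- + n → m ≡ m′
+m-+n≡+m′-+n⇒m≡m′ {m} {m′} {n} eq = ℤ.+-injective (begin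
  + m                     ≡⟨ add-sub (+ m) (+ n) ⟨
  (+ m ℤ.- + n) ℤ.+ + n   ≡⟨ cong (ℤ._+ + n) eq ⟩
  (+ m′ ℤ.- + n) ℤ.+ + n  ≡⟨ add-sub (+ m′) (+ n) ⟩
  + m′                    ∎)
  where
  open ≡-Reasoning
  add-sub : ∀ a b → (a ℤ.- b) ℤ.+ b ≡ a
  add-sub = ℤ-Solver.solve-∀

+[m∸n]≡+m-+n : ∀ {m n} → n ℕ.≤ m → + (m ∸ n) ≡ + m ℤ.- + n
+[m∸n]≡+m-+n {m} {n} n≤m = ≡.trans (≡.sym (ℤ.⊖-≥ n≤m)) (≡.sym (ℤ.m-n≡m⊖n m n))

+[m+m∸n]-+m≡+m-+n : ∀ {m n} → n ℕ.≤ m ℕ.+ m → + (m ℕ.+ m ∸ n) ℤ.- + m ≡ + m ℤ.- + n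
+[m+m∸n]-+m≡+m-+n {m} {n} n≤m+m = begin
  + (m ℕ.+ m ∸ n) ℤ.- + m             ≡⟨ cong (ℤ._- + m) (+[m∸n]≡+m-+n n≤m+m) ⟩
  + (m ℕ.+ m) ℤ.- + n ℤ.- + m         ≡⟨ cong (λ x → x ℤ.- + n ℤ.- + m) (ℤ.pos-+ m m) ⟩
  (+ m ℤ.+ + m) ℤ.- + n ℤ.- + m       ≡⟨ cancel (+ m) (+ n) ⟩
  + m ℤ.- + n                         ∎
  where
  open ≡-Reasoning
  cancel : ∀ a b → (a ℤ.+ a) ℤ.- b ℤ.- a ≡ a ℤ.- b
  cancel = ℤ-Solver.solve-∀

+[2[1+m]]-+[2[1+n]]≡2[+m-+n] : ∀ m n → + (2 ℕ.* suc m) ℤ.- + (2 ℕ.* suc n) ≡ + 2 ℤ.* (+ m ℤ.- + n)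
+[2[1+m]]-+[2[1+n]]≡2[+m-+n] m n = begin
  + (2 ℕ.* suc m) ℤ.- + (2 ℕ.* suc n)                 ≡⟨ ≡.cong₂ ℤ._-_ (double m) (double n) ⟩
  + 2 ℤ.* (+ 1 ℤ.+ + m) ℤ.- + 2 ℤ.* (+ 1 ℤ.+ + n)     ≡⟨ factor (+ m) (+ n) ⟩
  + 2 ℤ.* (+ m ℤ.- + n)                               ∎
  where
  open ≡-Reasoning
  double : ∀ k → + (2 ℕ.* suc k) ≡ + 2 ℤ.* (+ 1 ℤ.+ + k)
  double k = ≡.trans (ℤ.pos-* 2 (suc k)) (cong (+ 2 ℤ.*_) (ℤ.pos-+ 1 k))
  factor : ∀ a b → + 2 ℤ.* (+ 1 ℤ.+ a) ℤ.- + 2 ℤ.* (+ 1 ℤ.+ b) ≡ + 2 ℤ.* (a ℤ.- b)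
  factor = ℤ-Solver.solve-∀

2[1+m]∸1≡1+m+m : ∀ m → 2 ℕ.* suc m ∸ 1 ≡ suc (m ℕ.+ m)
2[1+m]∸1≡1+m+m m = ≡.trans (ℕ.+-suc m (m ℕ.+ 0)) (cong (suc ∘ (m ℕ.+_)) (ℕ.+-identityʳ m))

+[m+n]-+n≡+m : ∀ m n → + (m ℕ.+ n) ℤ.- + n ≡ + m
+[m+n]-+n≡+m m n = ≡.trans (ℤ.m-n≡m⊖n (m ℕ.+ n) n) (≡.trans (ℤ.⊖-≥ (ℕ.m≤n+m n m)) (cong +_ (ℕ.m+n∸n≡m m n)))

2[1+m]≤n+n : ∀ {m n} → suc m ℕ.≤ n → 2 ℕ.* suc m ℕ.≤ n ℕ.+ n
2[1+m]≤n+n {m} 1+m≤n = ℕ.+-mono-≤ 1+m≤n (ℕ.≤-trans (ℕ.≤-reflexive (ℕ.+-identityʳ (suc m))) 1+m≤n)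

2n+2n<1+4n : ∀ n → 2 ℕ.* n ℕ.+ 2 ℕ.* n ℕ.< suc (4 ℕ.* n)
2n+2n<1+4n n = s≤s (ℕ.≤-reflexive (2n+2n≡4n n))
  where
  2n+2n≡4n : ∀ n → 2 ℕ.* n ℕ.+ 2 ℕ.* n ≡ 4 ℕ.* n
  2n+2n≡4n = ℕ-Solver.solve-∀

module _ {c ℓ : Level} (R : CommutativeRing c ℓ) where
  open CommutativeRing R
  open Setup R
  open import Algebra.Properties.Semiring.Sum semiring
  open import Relation.Binary.Reasoning.Setoid setoid
  open import Algebra.Solver.CommutativeMonoid +-commutativeMonoid using (solve; _⊕_; _⊜_)
  open import Algebra.Properties.CommutativeSemigroup *-commutativeSemigroup using (interchange; x∙yz≈y∙xz)
  open import Algebra.Properties.Ring ring using (x[y-z]≈xy-xz)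
  open Semiring semiring using (rawSemiring)
  open import Algebra.Definitions.RawSemiring rawSemiring using (_^_)

  Σ[⋯]≡∑ : ∀ a b (f : ℕ → Carrier) → Σ[ a ⋯ b ] f ≡ ∑[ i < suc b ∸ a ] f (a ℕ.+ toℕ i)
  Σ[⋯]≡∑ a b f = Σ-applyUpTo (suc b ∸ a) id
    where
    Σ-applyUpTo : ∀ n (g : ℕ → ℕ) → Σ (map (a ℕ.+_) (applyUpTo g n)) f ≡ ∑[ i < n ] f (a ℕ.+ g (toℕ i))
    Σ-applyUpTo zero    g = ≡.refl
    Σ-applyUpTo (suc n) g = cong (λ s → f (a ℕ.+ g 0) + s) (Σ-applyUpTo n (g ∘ suc))

  ∑-last : ∀ n (g : ℕ → Carrier) → ∑[ i < suc n ] g (toℕ i) ≈ ∑[ i < n ] g (toℕ i) + g n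
  ∑-last n g = begin
    ∑[ i < suc n ] g (toℕ i)                           ≈⟨ sum-init-last (g ∘ toℕ) ⟩
    ∑[ i < n ] g (toℕ (inject₁ i)) + g (toℕ (fromℕ n)) ≡⟨ ≡.cong₂ _+_ (sum-cong-≗ {n} (cong g ∘ Fin.toℕ-inject₁)) (cong g (Fin.toℕ-fromℕ n)) ⟩
    ∑[ i < n ] g (toℕ i) + g n                         ∎

  ∑-single : ∀ {n} (h : ℕ → Carrier) {i₀} → i₀ ℕ.< n → (∀ i → i ≢ i₀ → h i ≈ 0#) →
             ∑[ i < n ] h (toℕ i) ≈ h i₀
  ∑-single {suc n} h {i₀} i₀<n h≈0 = begin
    ∑[ i < suc n ] h (toℕ i)                          ≈⟨ sum-remove (h ∘ toℕ) ⟩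
    h (toℕ j₀) + ∑[ i < n ] h (toℕ (punchIn j₀ i))    ≈⟨ +-congˡ (sum-cong-≋ (λ i → h≈0 _ (toℕ-punchIn≢i₀ i))) ⟩
    h (toℕ j₀) + ∑[ i < n ] 0#                        ≈⟨ +-congˡ (sum-replicate-zero n) ⟩
    h (toℕ j₀) + 0#                                   ≈⟨ +-identityʳ _ ⟩
    h (toℕ j₀)                                        ≡⟨ cong h (Fin.toℕ-fromℕ< i₀<n) ⟩
    h i₀                                              ∎
    where
    j₀ : Fin (suc n)
    j₀ = fromℕ< i₀<n
    toℕ-punchIn≢i₀ : ∀ i → toℕ (punchIn j₀ i) ≢ i₀
    toℕ-punchIn≢i₀ i eq = Fin.punchInᵢ≢i j₀ i (Fin.toℕ-injective (≡.trans eq (≡.sym (Fin.toℕ-fromℕ< i₀<n))))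

  [≡ᶻ]-≡ : ∀ {x y} → x ≡ y → [ x ≡ᶻ y ] ≈ 1#
  [≡ᶻ]-≡ {x} {y} x≡y = reflexive (cong (λ b → if b then 1# else 0#) (dec-true (x ℤ.≟ y) x≡y))

  [≡ᶻ]-≢ : ∀ {x y} → x ≢ y → [ x ≡ᶻ y ] ≈ 0#
  [≡ᶻ]-≢ {x} {y} x≢y = reflexive (cong (λ b → if b then 1# else 0#) (dec-false (x ℤ.≟ y) x≢y))

  ∑-indicator : ∀ {n} (e : ℕ → ℤ) → (∀ {i j} → e i ≡ e j → i ≡ j) →
                (h : ℕ → Carrier) {i₀ : ℕ} {t : ℤ} → i₀ ℕ.< n → e i₀ ≡ t →
                ∑[ i < n ] ([ e (toℕ i) ≡ᶻ t ] * h (toℕ i)) ≈ h i₀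
  ∑-indicator {n} e e-injective h {i₀} {t} i₀<n eᵢ₀≡t = begin
    ∑[ i < n ] ([ e (toℕ i) ≡ᶻ t ] * h (toℕ i)) ≈⟨ ∑-single {n} (λ i → [ e i ≡ᶻ t ] * h i) i₀<n off-i₀ ⟩
    [ e i₀ ≡ᶻ t ] * h i₀                        ≈⟨ *-congʳ ([≡ᶻ]-≡ eᵢ₀≡t) ⟩
    1# * h i₀                                   ≈⟨ *-identityˡ (h i₀) ⟩
    h i₀                                        ∎
    where
    off-i₀ : ∀ i → i ≢ i₀ → [ e i ≡ᶻ t ] * h i ≈ 0#
    off-i₀ i i≢i₀ = begin
      [ e i ≡ᶻ t ] * h i ≈⟨ *-congʳ ([≡ᶻ]-≢ (λ eᵢ≡t → i≢i₀ (e-injective (≡.trans eᵢ≡t (≡.sym eᵢ₀≡t))))) ⟩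
      0# * h i           ≈⟨ zeroˡ (h i) ⟩
      0#                 ∎

  -- The constant term is 1 whatever h 0 is (for B below, B 0 would be 2).
  partialSum : (ℕ → Carrier) → ℕ → Carrier
  partialSum h k = 1# + ∑[ r < k ] h (suc (toℕ r))

  partialSum-suc : ∀ h k → partialSum h (suc k) ≈ partialSum h k + h (suc k)
  partialSum-suc h k = trans (+-congˡ (∑-last k (h ∘ suc))) (sym (+-assoc 1# _ (h (suc k))))

  ∑-symmetric : ∀ k (f : ℤ → Carrier) →
                ∑[ i < suc (k ℕ.+ k) ] f (+ k ℤ.- + toℕ i) ≈
                f (+ 0) + ∑[ r < k ] (f (+ suc (toℕ r)) + f -[1+ toℕ r ])
  ∑-symmetric zero    f = refl
  ∑-symmetric (suc k) f = begin
    ∑[ i < suc (suc k ℕ.+ suc k) ] g (toℕ i)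
      ≡⟨ cong (λ n → ∑[ i < suc n ] g (toℕ i)) (ℕ.+-suc (suc k) k) ⟩
    g 0 + ∑[ i < suc (suc (k ℕ.+ k)) ] g (suc (toℕ i))
      ≈⟨ +-cong (reflexive (cong f (ℤ.+-identityʳ (+ suc k)))) (∑-last (suc (k ℕ.+ k)) (g ∘ suc)) ⟩
    f (+ suc k) + (∑[ i < suc (k ℕ.+ k) ] g (suc (toℕ i)) + g (suc (suc (k ℕ.+ k))))
      ≈⟨ +-congˡ (reflexive (≡.cong₂ _+_ (sum-cong-≗ {suc (k ℕ.+ k)} (cong f ∘ +[1+m]-+[1+n]≡+m-+n k ∘ toℕ)) (cong f last-exponent))) ⟩
    f (+ suc k) + (∑[ i < suc (k ℕ.+ k) ] f (+ k ℤ.- + toℕ i) + f -[1+ k ])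
      ≈⟨ +-congˡ (+-congʳ (∑-symmetric k f)) ⟩
    f (+ suc k) + ((f (+ 0) + S) + f -[1+ k ])
      ≈⟨ solve 4 (λ a b s z → a ⊕ ((b ⊕ s) ⊕ z) ⊜ b ⊕ (s ⊕ (a ⊕ z))) refl (f (+ suc k)) (f (+ 0)) S (f -[1+ k ]) ⟩
    f (+ 0) + (S + (f (+ suc k) + f -[1+ k ]))
      ≈⟨ +-congˡ (∑-last k h) ⟨
    f (+ 0) + ∑[ r < suc k ] h (toℕ r)
      ∎
    where
    g : ℕ → Carrier
    g i = f (+ suc k ℤ.- + i)
    h : ℕ → Carrier
    h r = f (+ suc r) + f -[1+ r ]
    S : Carrier
    S = ∑[ r < k ] h (toℕ r)
    last-exponent : + suc k ℤ.- + suc (suc (k ℕ.+ k)) ≡ -[1+ k ]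
    last-exponent = ≡.trans (+[1+m]-+[1+n]≡+m-+n k (suc (k ℕ.+ k))) (+m-+[1+m+m]≡-[1+m] k)

  ∑-even-symmetric : ∀ k (f : ℤ → Carrier) →
    ∑[ j < 2 ℕ.* suc k ∸ 1 ] f (+ (2 ℕ.* suc k) ℤ.- + (2 ℕ.* suc (toℕ j))) ≈
    f (+ 0) + ∑[ r < k ] (f (+ (2 ℕ.* suc (toℕ r))) + f (ℤ.- + (2 ℕ.* suc (toℕ r))))
  ∑-even-symmetric k f = begin
    ∑[ j < 2 ℕ.* suc k ∸ 1 ] f (+ (2 ℕ.* suc k) ℤ.- + (2 ℕ.* suc (toℕ j)))
      ≡⟨ cong (λ n → ∑[ j < n ] f (+ (2 ℕ.* suc k) ℤ.- + (2 ℕ.* suc (toℕ j)))) (2[1+m]∸1≡1+m+m k) ⟩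
    ∑[ j < suc (k ℕ.+ k) ] f (+ (2 ℕ.* suc k) ℤ.- + (2 ℕ.* suc (toℕ j)))
      ≡⟨ sum-cong-≗ {suc (k ℕ.+ k)} (cong f ∘ +[2[1+m]]-+[2[1+n]]≡2[+m-+n] k ∘ toℕ) ⟩
    ∑[ j < suc (k ℕ.+ k) ] f (+ 2 ℤ.* (+ k ℤ.- + toℕ j))
      ≈⟨ ∑-symmetric k (f ∘ (+ 2 ℤ.*_)) ⟩
    f (+ 0) + ∑[ r < k ] (f (+ (2 ℕ.* suc (toℕ r))) + f (ℤ.- + (2 ℕ.* suc (toℕ r))))
      ∎

  x*y≈1⇒xⁿ*yⁿ≈1 : ∀ {x y} → x * y ≈ 1# → ∀ n → x ^ n * y ^ n ≈ 1#
  x*y≈1⇒xⁿ*yⁿ≈1 x*y≈1 zero    = *-identityˡ 1#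
  x*y≈1⇒xⁿ*yⁿ≈1 {x} {y} x*y≈1 (suc n) = begin
    (x * x ^ n) * (y * y ^ n) ≈⟨ interchange x (x ^ n) y (y ^ n) ⟩
    (x * y) * (x ^ n * y ^ n) ≈⟨ *-cong x*y≈1 (x*y≈1⇒xⁿ*yⁿ≈1 x*y≈1 n) ⟩
    1# * 1#                   ≈⟨ *-identityˡ 1# ⟩
    1#                        ∎

  x-y+y≈x : ∀ x y → x - y + y ≈ x
  x-y+y≈x x y = begin
    x - y + y      ≈⟨ +-assoc x (- y) y ⟩
    x + (- y + y)  ≈⟨ +-congˡ (-‿inverseˡ y) ⟩
    x + 0#         ≈⟨ +-identityʳ x ⟩
    x              ∎

  [x-1]*y+y≈x*y : ∀ x y → (x - 1#) * y + y ≈ x * y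
  [x-1]*y+y≈x*y x y = begin
    (x - 1#) * y + y       ≈⟨ +-congˡ (*-identityˡ y) ⟨
    (x - 1#) * y + 1# * y  ≈⟨ distribʳ y (x - 1#) 1# ⟨
    (x - 1# + 1#) * y      ≈⟨ *-congʳ (x-y+y≈x x 1#) ⟩
    x * y                  ∎

  module _ (p : ℕ) (pinv δ δinv : Carrier) where

    F : ℤ → Carrier
    F = Fcoeff p pinv δ δinv

    B : ℕ → Carrier
    B n = zpow δ δinv (+ (2 ℕ.* n)) + zpow δ δinv (ℤ.- + (2 ℕ.* n))

    evenCoeff : ℕ → Carrier
    evenCoeff n = A p δ δinv n * pinv ^ n

    F-zero : F (+ 0) ≈ 1#
    F-zero = trans (+-identityʳ _) ([≡ᶻ]-≡ {+ 0} ≡.refl)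

    F-even : ∀ r → F (+ (2 ℕ.* suc r)) ≈ evenCoeff (suc r)
    F-even r = begin
      [ + n ≡ᶻ + 0 ] + Σ[ 1 ⋯ n ] (λ i → [ + n ≡ᶻ + (2 ℕ.* i) ] * evenCoeff i)
        ≈⟨ +-cong ([≡ᶻ]-≢ {+ n} {+ 0} (λ ())) (reflexive (Σ[⋯]≡∑ 1 n _)) ⟩
      0# + ∑[ i < n ] ([ + n ≡ᶻ + (2 ℕ.* suc (toℕ i)) ] * evenCoeff (suc (toℕ i)))
        ≈⟨ +-identityˡ _ ⟩
      ∑[ i < n ] ([ + n ≡ᶻ + (2 ℕ.* suc (toℕ i)) ] * evenCoeff (suc (toℕ i)))
        ≈⟨ ∑-single {n} (λ i → [ + n ≡ᶻ + (2 ℕ.* suc i) ] * evenCoeff (suc i)) (s≤s (ℕ.m≤m+n r _)) off-r ⟩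
      [ + n ≡ᶻ + n ] * evenCoeff (suc r)
        ≈⟨ trans (*-congʳ ([≡ᶻ]-≡ {+ n} ≡.refl)) (*-identityˡ _) ⟩
      evenCoeff (suc r)
        ∎
      where
      n : ℕ
      n = 2 ℕ.* suc r
      off-r : ∀ i → i ≢ r → [ + n ≡ᶻ + (2 ℕ.* suc i) ] * evenCoeff (suc i) ≈ 0#
      off-r i i≢r = trans (*-congʳ ([≡ᶻ]-≢ (i≢r ∘ ≡.sym ∘ ℕ.suc-injective ∘ ℕ.*-cancelˡ-≡ (suc r) (suc i) 2 ∘ ℤ.+-injective))) (zeroˡ _)

    ∑-F-window : ∀ k → ∑[ j < 2 ℕ.* suc k ∸ 1 ] F (ℤ.- (+ (2 ℕ.* suc k) ℤ.- + (2 ℕ.* suc (toℕ j)))) ≈ partialSum evenCoeff k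
    ∑-F-window k = trans (∑-even-symmetric k (F ∘ ℤ.-_))
      (+-cong F-zero (sum-cong-≋ {k} (λ r → trans (+-identityˡ _) (F-even (toℕ r)))))

    A+[p-1]*partialSum≈B : ∀ k → A p δ δinv (suc k) + (⟦ p ⟧ - 1#) * partialSum B k ≈ B (suc k)
    A+[p-1]*partialSum≈B k = begin
      B (suc k) - (⟦ p ⟧ - 1#) * Σ[ 1 ⋯ 2 ℕ.* suc k ∸ 1 ] δ-power + (⟦ p ⟧ - 1#) * partialSum B k
        ≈⟨ +-congʳ (+-congˡ (-‿cong (*-congˡ (trans (reflexive (Σ[⋯]≡∑ 1 (2 ℕ.* suc k ∸ 1) δ-power)) (∑-even-symmetric k (zpow δ δinv)))))) ⟩
      B (suc k) - (⟦ p ⟧ - 1#) * partialSum B k + (⟦ p ⟧ - 1#) * partialSum B k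
        ≈⟨ x-y+y≈x (B (suc k)) _ ⟩
      B (suc k)
        ∎
      where
      δ-power : ℕ → Carrier
      δ-power j = zpow δ δinv (+ (2 ℕ.* suc k) ℤ.- + (2 ℕ.* j))

    integral-zero : integral p pinv δ δinv 0 ≈ 1#
    integral-zero = begin
      [ + 0 ≡ᶻ + 0 ] * F (+ 0) + 0# ≈⟨ +-identityʳ _ ⟩
      [ + 0 ≡ᶻ + 0 ] * F (+ 0)      ≈⟨ *-cong ([≡ᶻ]-≡ {+ 0} ≡.refl) F-zero ⟩
      1# * 1#                       ≈⟨ *-identityˡ 1# ⟩
      1#                            ∎

    φ2coeff-suc-* : ∀ k e x → φ2coeff p pinv (suc k) e * x ≈
      ⟦ p ⟧ ^ suc k * (([ e ≡ᶻ + (2 ℕ.* suc k) ] * x + [ e ≡ᶻ ℤ.- + (2 ℕ.* suc k) ] * x)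
        + (1# - pinv) * ∑[ j < 2 ℕ.* suc k ∸ 1 ] ([ e ≡ᶻ + (2 ℕ.* suc k) ℤ.- + (2 ℕ.* suc (toℕ j)) ] * x))
    φ2coeff-suc-* k e x = begin
      ⟦ p ⟧ ^ suc k * ((I₊ + I₋) + (1# - pinv) * Σ[ 1 ⋯ m ∸ 1 ] I) * x
        ≈⟨ *-assoc _ _ x ⟩
      ⟦ p ⟧ ^ suc k * (((I₊ + I₋) + (1# - pinv) * Σ[ 1 ⋯ m ∸ 1 ] I) * x)
        ≈⟨ *-congˡ (trans (distribʳ x _ _) (+-cong (distribʳ x I₊ I₋) (*-assoc _ _ x))) ⟩
      ⟦ p ⟧ ^ suc k * ((I₊ * x + I₋ * x) + (1# - pinv) * (Σ[ 1 ⋯ m ∸ 1 ] I * x))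
        ≈⟨ *-congˡ (+-congˡ (*-congˡ (trans (*-congʳ (reflexive (Σ[⋯]≡∑ 1 (m ∸ 1) I))) (*-distribʳ-sum {m ∸ 1} x (λ j → I (suc (toℕ j))))))) ⟩
      ⟦ p ⟧ ^ suc k * ((I₊ * x + I₋ * x) + (1# - pinv) * ∑[ j < m ∸ 1 ] (I (suc (toℕ j)) * x))
        ∎
      where
      m : ℕ
      m = 2 ℕ.* suc k
      I₊ I₋ : Carrier
      I₊ = [ e ≡ᶻ + m ]
      I₋ = [ e ≡ᶻ ℤ.- + m ]
      I : ℕ → Carrier
      I j = [ e ≡ᶻ + m ℤ.- + (2 ℕ.* j) ]

    module Pairing (k : ℕ) where

      N m L : ℕ
      N = suc k
      m = 2 ℕ.* N
      L = suc (4 ℕ.* N)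

      e : ℕ → ℤ
      e i = + i ℤ.- + m

      t : ℕ → ℤ
      t j = + m ℤ.- + (2 ℕ.* suc j)

      X Y W : ℕ → Carrier
      X i = [ e i ≡ᶻ + m ] * F (ℤ.- e i)
      Y i = [ e i ≡ᶻ ℤ.- + m ] * F (ℤ.- e i)
      W i = ∑[ j < m ∸ 1 ] ([ e i ≡ᶻ t (toℕ j) ] * F (ℤ.- e i))

      ∑-coeff : ∀ {i₀ x} → i₀ ℕ.≤ m ℕ.+ m → e i₀ ≡ x →
                ∑[ i < L ] ([ e (toℕ i) ≡ᶻ x ] * F (ℤ.- e (toℕ i))) ≈ F (ℤ.- x)
      ∑-coeff {i₀} {x} i₀≤m+m eᵢ₀≡x = begin
        ∑[ i < L ] ([ e (toℕ i) ≡ᶻ x ] * F (ℤ.- e (toℕ i)))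
          ≈⟨ ∑-indicator {L} e (+m-+n≡+m′-+n⇒m≡m′ {n = m}) (F ∘ ℤ.-_ ∘ e) {i₀} (ℕ.≤-<-trans i₀≤m+m (2n+2n<1+4n N)) eᵢ₀≡x ⟩
        F (ℤ.- e i₀)
          ≡⟨ cong (F ∘ ℤ.-_) eᵢ₀≡x ⟩
        F (ℤ.- x)
          ∎

      -- F vanishes at negative exponents, so F (ℤ.- + m) reduces to 0#.
      ∑X≈0 : ∑[ i < L ] X (toℕ i) ≈ 0#
      ∑X≈0 = ∑-coeff ℕ.≤-refl (+[m+n]-+n≡+m m m)

      ∑Y≈evenCoeff : ∑[ i < L ] Y (toℕ i) ≈ evenCoeff N
      ∑Y≈evenCoeff = trans (∑-coeff ℕ.z≤n (ℤ.+-identityˡ (ℤ.- + m))) (F-even k)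

      ∑W≈partialSum : ∑[ i < L ] W (toℕ i) ≈ partialSum evenCoeff k
      ∑W≈partialSum = begin
        ∑[ i < L ] W (toℕ i)
          ≈⟨ ∑-comm {L} {m ∸ 1} (λ i j → [ e (toℕ i) ≡ᶻ t (toℕ j) ] * F (ℤ.- e (toℕ i))) ⟩
        ∑[ j < m ∸ 1 ] ∑[ i < L ] ([ e (toℕ i) ≡ᶻ t (toℕ j) ] * F (ℤ.- e (toℕ i)))
          ≈⟨ sum-cong-≋ {m ∸ 1} (λ j → ∑-coeff (ℕ.m∸n≤m (m ℕ.+ m) (2 ℕ.* suc (toℕ j))) (e[m+m∸2[1+j]]≡t (Fin.toℕ<n j))) ⟩
        ∑[ j < m ∸ 1 ] F (ℤ.- t (toℕ j))
          ≈⟨ ∑-F-window k ⟩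
        partialSum evenCoeff k
          ∎
        where
        e[m+m∸2[1+j]]≡t : ∀ {j} → j ℕ.< m ∸ 1 → e (m ℕ.+ m ∸ 2 ℕ.* suc j) ≡ t j
        e[m+m∸2[1+j]]≡t j<m∸1 = +[m+m∸n]-+m≡+m-+n {m} (2[1+m]≤n+n (ℕ.≤-trans j<m∸1 (ℕ.m∸n≤m m 1)))

    integral-suc-expansion : ∀ k → integral p pinv δ δinv (suc k) ≈
      ⟦ p ⟧ ^ suc k * (evenCoeff (suc k) + (1# - pinv) * partialSum evenCoeff k)
    integral-suc-expansion k = begin
      integral p pinv δ δinv N
        ≡⟨ Σ[⋯]≡∑ 0 (4 ℕ.* N) _ ⟩
      ∑[ i < L ] (φ2coeff p pinv N (e (toℕ i)) * F (ℤ.- e (toℕ i)))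
        ≈⟨ sum-cong-≋ {L} (λ i → φ2coeff-suc-* k (e (toℕ i)) (F (ℤ.- e (toℕ i)))) ⟩
      ∑[ i < L ] (P * ((X (toℕ i) + Y (toℕ i)) + (1# - pinv) * W (toℕ i)))
        ≈⟨ *-distribˡ-sum {L} P (λ i → (X (toℕ i) + Y (toℕ i)) + (1# - pinv) * W (toℕ i)) ⟨
      P * ∑[ i < L ] ((X (toℕ i) + Y (toℕ i)) + (1# - pinv) * W (toℕ i))
        ≈⟨ *-congˡ (trans (∑-distrib-+ {L} (λ i → X (toℕ i) + Y (toℕ i)) (λ i → (1# - pinv) * W (toℕ i)))
                          (+-cong (∑-distrib-+ {L} (X ∘ toℕ) (Y ∘ toℕ)) (sym (*-distribˡ-sum {L} (1# - pinv) (W ∘ toℕ))))) ⟩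
      P * ((∑[ i < L ] X (toℕ i) + ∑[ i < L ] Y (toℕ i)) + (1# - pinv) * ∑[ i < L ] W (toℕ i))
        ≈⟨ *-congˡ (+-cong (trans (+-congʳ ∑X≈0) (+-identityˡ _)) (*-congˡ ∑W≈partialSum)) ⟩
      P * (∑[ i < L ] Y (toℕ i) + (1# - pinv) * partialSum evenCoeff k)
        ≈⟨ *-congˡ (+-congʳ ∑Y≈evenCoeff) ⟩
      P * (evenCoeff N + (1# - pinv) * partialSum evenCoeff k)
        ∎
      where
      open Pairing k
      P : Carrier
      P = ⟦ p ⟧ ^ N

    module _ (p*pinv≈1 : ⟦ p ⟧ * pinv ≈ 1#) where

      pⁿ*evenCoeff≈A : ∀ n → ⟦ p ⟧ ^ n * evenCoeff n ≈ A p δ δinv n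
      pⁿ*evenCoeff≈A n = begin
        ⟦ p ⟧ ^ n * (A p δ δinv n * pinv ^ n) ≈⟨ x∙yz≈y∙xz (⟦ p ⟧ ^ n) (A p δ δinv n) (pinv ^ n) ⟩
        A p δ δinv n * (⟦ p ⟧ ^ n * pinv ^ n) ≈⟨ *-congˡ (x*y≈1⇒xⁿ*yⁿ≈1 p*pinv≈1 n) ⟩
        A p δ δinv n * 1#                     ≈⟨ *-identityʳ _ ⟩
        A p δ δinv n                          ∎

      pᵏ*partialSum-evenCoeff≈partialSum-B : ∀ k → ⟦ p ⟧ ^ k * partialSum evenCoeff k ≈ partialSum B k
      pᵏ*partialSum-evenCoeff≈partialSum-B zero    = *-identityˡ _
      pᵏ*partialSum-evenCoeff≈partialSum-B (suc k) = begin
        ⟦ p ⟧ ^ suc k * partialSum evenCoeff (suc k)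
          ≈⟨ *-congˡ (partialSum-suc evenCoeff k) ⟩
        ⟦ p ⟧ ^ suc k * (partialSum evenCoeff k + evenCoeff (suc k))
          ≈⟨ distribˡ _ _ _ ⟩
        ⟦ p ⟧ * (⟦ p ⟧ ^ k) * partialSum evenCoeff k + ⟦ p ⟧ ^ suc k * evenCoeff (suc k)
          ≈⟨ +-cong (trans (*-assoc _ _ _) (*-congˡ (pᵏ*partialSum-evenCoeff≈partialSum-B k))) (pⁿ*evenCoeff≈A (suc k)) ⟩
        ⟦ p ⟧ * U + A p δ δinv (suc k)
          ≈⟨ +-congʳ ([x-1]*y+y≈x*y ⟦ p ⟧ U) ⟨
        (⟦ p ⟧ - 1#) * U + U + A p δ δinv (suc k)
          ≈⟨ solve 3 (λ a u b → (a ⊕ u) ⊕ b ⊜ u ⊕ (b ⊕ a)) refl ((⟦ p ⟧ - 1#) * U) U (A p δ δinv (suc k)) ⟩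
        U + (A p δ δinv (suc k) + (⟦ p ⟧ - 1#) * U)
          ≈⟨ +-congˡ (A+[p-1]*partialSum≈B k) ⟩
        U + B (suc k)
          ≈⟨ partialSum-suc B k ⟨
        partialSum B (suc k)
          ∎
        where
        U : Carrier
        U = partialSum B k

      pᴺ*[evenCoeff+[1-pinv]*partialSum]≈B : ∀ k →
        ⟦ p ⟧ ^ suc k * (evenCoeff (suc k) + (1# - pinv) * partialSum evenCoeff k) ≈ B (suc k)
      pᴺ*[evenCoeff+[1-pinv]*partialSum]≈B k = begin
        ⟦ p ⟧ ^ suc k * (evenCoeff (suc k) + (1# - pinv) * partialSum evenCoeff k)
          ≈⟨ distribˡ _ _ _ ⟩
        ⟦ p ⟧ ^ suc k * evenCoeff (suc k) + (⟦ p ⟧ * ⟦ p ⟧ ^ k) * ((1# - pinv) * partialSum evenCoeff k)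
          ≈⟨ +-cong (pⁿ*evenCoeff≈A (suc k)) (interchange ⟦ p ⟧ _ _ _) ⟩
        A p δ δinv (suc k) + (⟦ p ⟧ * (1# - pinv)) * (⟦ p ⟧ ^ k * partialSum evenCoeff k)
          ≈⟨ +-congˡ (*-cong p*[1-pinv]≈p-1 (pᵏ*partialSum-evenCoeff≈partialSum-B k)) ⟩
        A p δ δinv (suc k) + (⟦ p ⟧ - 1#) * partialSum B k
          ≈⟨ A+[p-1]*partialSum≈B k ⟩
        B (suc k)
          ∎
        where
        p*[1-pinv]≈p-1 : ⟦ p ⟧ * (1# - pinv) ≈ ⟦ p ⟧ - 1#
        p*[1-pinv]≈p-1 = trans (x[y-z]≈xy-xz ⟦ p ⟧ 1# pinv) (+-cong (*-identityʳ ⟦ p ⟧) (-‿cong p*pinv≈1))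

      integral-suc : ∀ k → integral p pinv δ δinv (suc k) ≈ B (suc k)
      integral-suc k = trans (integral-suc-expansion k) (pᴺ*[evenCoeff+[1-pinv]*partialSum]≈B k)

proposition6p1 : {c ℓ : Level} (R : CommutativeRing c ℓ) →
    let open CommutativeRing R in
    let open Setup R in
    (p : ℕ) → Prime p → (pinv : Carrier) → ⟦ p ⟧ * pinv ≈ 1# →
    (δ δinv : Carrier) → δ * δinv ≈ 1# →
    (n : ℕ) →
    integral p pinv δ δinv n ≈
      case-n n 1# (zpow δ δinv (+ (2 ℕ.* n)) + zpow δ δinv (ℤ.- (+ (2 ℕ.* n))))
proposition6p1 R p _ pinv p*pinv≈1 δ δinv _ zero    = integral-zero R p pinv δ δinv
proposition6p1 R p _ pinv p*pinv≈1 δ δinv _ (suc k) = integral-suc R p pinv δ δinv p*pinv≈1 k
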